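{- For all cathoristic logic formulae $\phi,\psi$: if $\phi\models\psi$ then $\mathrm{Simpl}(\phi)\preceq\mathrm{Simpl}(\psi)$.
   Context: Fix a non-empty set $\Sigma$ of actions. Formulae: $\phi ::= \top \mid \phi\land\psi \mid \langle a\rangle\phi \mid\ !A$ with $a\in\Sigma$, $A$ a finite subset of $\Sigma$. A cathoristic transition system is $\mathcal{L}=(S,\rightarrow,\lambda)$ with $\rightarrow\subseteq S\times\Sigma\times S$ deterministic and $\lambda:S\to\mathcal{P}(\Sigma)$ such that $\{a\mid\exists t.\,s\xrightarrow{a}t\}\subseteq\lambda(s)$ and each $\lambda(s)$ is finite or $\Sigma$; a cathoristic model is $(\mathcal{L},s)$, $s\in S$. Satisfaction: $\top$ always; $\land$ componentwise; $(\mathcal{L},s)\models\langle a\rangle\phi$ iff some $s\xrightarrow{a}t$ has $(\mathcal{L},t)\models\phi$; $(\mathcal{L},s)\models\ !A$ iff $\lambda(s)\subseteq A$; $\phi\models\psi$ means every model of $\phi$ is a model of $\psi$. A simulation from $(\mathcal{L}_1,s_1)$ to $(\mathcal{L}_2,s_2)$ is $R\subseteq S_1\times S_2$ containing $(s_1,s_2)$ such that whenever $(x,y)\in R$ and $x\xrightarrow{a}_1x'$ there is $y'$ with $y\xrightarrow{a}_2y'$, $(x',y')\in R$, and $\lambda_1(x)\supseteq\lambda_2(y)$ for all $(x,y)\in R$. $\mathfrak{M}\preceq\mathfrak{M}'$ iff there is a simulation from $\mathfrak{M}'$ to $\mathfrak{M}$; $\simeq$ is $\preceq\cap\preceq^{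 -1}$. Models are considered up to $\simeq$, and a bottom element $\bot$ is added with $\bot\preceq\mathfrak{M}$ for all $\mathfrak{M}$ and $\bot\models\phi$ for all $\phi$; the resulting ordered collection is a bounded lattice, and $\mathrm{glb}$ denotes its binary greatest lower bound. $\mathrm{Simpl}$: $\mathrm{Simpl}(\top)=((\{v\},\emptyset,\{v\mapsto\Sigma\}),v)$; $\mathrm{Simpl}(!A)=((\{v\},\emptyset,\{v\mapsto A\}),v)$; $\mathrm{Simpl}(\phi_1\land\phi_2)=\mathrm{glb}(\mathrm{Simpl}(\phi_1),\mathrm{Simpl}(\phi_2))$; $\mathrm{Simpl}(\langle a\rangle\phi)=\bot$ if $\mathrm{Simpl}(\phi)=\bot$, and otherwise, with $\mathrm{Simpl}(\phi)=((S,\rightarrow,\lambda),w)$, $\mathrm{Simpl}(\langle a\rangle\phi)=((S\cup\{w'\},\rightarrow\cup\{(w',a,w)\},\lambda\cup\{w'\mapsto\Sigma\}),w')$ for a fresh $w'\notin S$. -}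

module Defs where

open import Level using (Lift)
open import Data.Unit using (⊤; tt)
open import Data.Empty using (⊥)
open import Data.Maybe using (Maybe; just; nothing)
open import Data.Product using (Σ-syntax; _×_; _,_)
open import Data.List using (List)
open import Data.List.Membership.Propositional using (_∈_)
open import Relation.Binary.PropositionalEquality using (_≡_; refl; cong)

data Fm (Act : Set) : Set where
  ⊤f   : Fm Act
  _∧f_ : Fm Act → Fm Act → Fm Act
  ⟨_⟩_ : Act → Fm Act → Fm Act
  !_   : List Act → Fm Act          -- !A, A a finite subset of Act

data Label (Act : Set) : Set where
  all : Label Act
  fin : List Act → Label Act

_∈L_ : {Act : Set} → Act → Label Act → Set
a ∈L all     = ⊤
a ∈L fin xs  = a ∈ xs

_⊆L_ : {Act : Set} → Label Act → Label Act → Set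
l ⊆L l' = ∀ a → a ∈L l → a ∈L l'

record CTS (Act : Set) : Set₁ where
  field
    S       : Set
    Tr      : S → Act → S → Set
    lab     : S → Label Act
    det     : ∀ {s a t t'} → Tr s a t → Tr s a t' → t ≡ t'
    enabled : ∀ {s a t} → Tr s a t → a ∈L lab s

record Model (Act : Set) : Set₁ where
  constructor _,,_
  field
    cts   : CTS Act
    state : CTS.S cts

open CTS
open Model

_⊨[_]_ : {Act : Set} (L : CTS Act) → S L → Fm Act → Set
L ⊨[ s ] ⊤f        = ⊤
L ⊨[ s ] (φ ∧f ψ)  = (L ⊨[ s ] φ) × (L ⊨[ s ] ψ)
L ⊨[ s ] (⟨ a ⟩ φ) = Σ[ t ∈ S L ] (Tr L s a t × (L ⊨[ t ] φ))
L ⊨[ s ] (! A)     = lab L s ⊆L fin A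

_⊨m_ : {Act : Set} → Model Act → Fm Act → Set
M ⊨m φ = cts M ⊨[ state M ] φ

-- semantic consequence φ ⊨ ψ (the extra ⊥ model satisfies everything)
_⊨_ : {Act : Set} → Fm Act → Fm Act → Set₁
φ ⊨ ψ = ∀ M → M ⊨m φ → M ⊨m ψ

record IsSimulation {Act : Set} (M₁ M₂ : Model Act)
       (R : S (cts M₁) → S (cts M₂) → Set) : Set where
  field
    start : R (state M₁) (state M₂)
    step  : ∀ {x y a x'} → R x y → Tr (cts M₁) x a x' →
            Σ[ y' ∈ S (cts M₂) ] (Tr (cts M₂) y a y' × R x' y')
    label : ∀ {x y} → R x y → lab (cts M₂) y ⊆L lab (cts M₁) x

Simulation : {Act : Set} → Model Act → Model Act → Set₁
Simulation M₁ M₂ = Σ[ R ∈ (S (cts M₁) → S (cts M₂) → Set) ] IsSimulation M₁ M₂ R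

_⪯_ : {Act : Set} → Model Act → Model Act → Set₁
M ⪯ M' = Simulation M' M

-- models extended with a bottom element ⊥ (represented by nothing)
_⊑_ : {Act : Set} → Maybe (Model Act) → Maybe (Model Act) → Set₁
nothing ⊑ _      = Lift _ ⊤
just M ⊑ nothing = Lift _ ⊥
just M ⊑ just N  = M ⪯ N

IsGlb : {Act : Set} → Maybe (Model Act) → Maybe (Model Act) → Maybe (Model Act) → Set₁
IsGlb m₁ m₂ g = (g ⊑ m₁) × (g ⊑ m₂) × (∀ z → z ⊑ m₁ → z ⊑ m₂ → z ⊑ g)

single : {Act : Set} → Label Act → Model Act
single {Act} l = record { S = ⊤ ; Tr = λ _ _ _ → ⊥ ; lab = λ _ → l
                        ; det = λ () ; enabled = λ () } ,, tt

-- prefixing: add a fresh root w' (= nothing) with w' -a-> w, λ(w') = Act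
module Prefix {Act : Set} (a : Act) (M : Model Act) where
  L = cts M
  w = state M

  data PTr : Maybe (S L) → Act → Maybe (S L) → Set where
    old : ∀ {x b y} → Tr L x b y → PTr (just x) b (just y)
    new : PTr nothing a (just w)

  plab : Maybe (S L) → Label Act
  plab nothing  = all
  plab (just x) = lab L x

  pdet : ∀ {s b t t'} → PTr s b t → PTr s b t' → t ≡ t'
  pdet (old p) (old q) = cong just (det L p q)
  pdet new new = refl

  penabled : ∀ {s b t} → PTr s b t → b ∈L plab s
  penabled (old p) = enabled L p
  penabled new = tt

  prefixed : Model Act
  prefixed = record { S = Maybe (S L) ; Tr = PTr ; lab = plab
                    ; det = pdet ; enabled = penabled } ,, nothing

prefix : {Act : Set} → Act → Model Act → Model Act
prefix a M = Prefix.prefixed a M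

-- Simpl, as a relation: Simpl φ m  means  m is (a representative of) Simpl(φ);
-- nothing stands for ⊥.  The conjunction case allows any glb.

data Simpl {Act : Set} : Fm Act → Maybe (Model Act) → Set₁ where
  s-⊤   : Simpl ⊤f (just (single all))
  s-!   : ∀ A → Simpl (! A) (just (single (fin A)))
  s-∧   : ∀ {φ₁ φ₂ m₁ m₂ g} → Simpl φ₁ m₁ → Simpl φ₂ m₂ → IsGlb m₁ m₂ g →
          Simpl (φ₁ ∧f φ₂) g
  s-⟨⟩⊥ : ∀ {a φ} → Simpl φ nothing → Simpl (⟨ a ⟩ φ) nothing
  s-⟨⟩  : ∀ {a φ M} → Simpl φ (just M) → Simpl (⟨ a ⟩ φ) (just (prefix a M))

module Submission where

-- Simpl ψ is the characteristic (simulation-greatest) model of ψ: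
--   (soundness)      Simpl φ, when it is a model M, satisfies φ;
--   (characteristic) every model M of ψ lies below Simpl ψ, i.e. just M ⊑ Simpl ψ.
-- Given φ ⊨ ψ and m = Simpl φ, either m = ⊥ (below everything), or m is a model
-- of φ, hence of ψ, hence below Simpl ψ.
--
-- Both halves rest on one general fact: the formulae of cathoristic logic are
-- positive, so they are preserved along simulations.  Soundness for ⟨a⟩φ uses it
-- through the embedding of a model into its prefixed model; the characteristic
-- property for ⟨a⟩ψ lifts a simulation from Simpl ψ into a successor state to
-- one from the prefixed model; for ∧ it is exactly the glb universal property.

open import Defs
open import Data.Maybe using (Maybe; just; nothing)
open import Level using (lift)
open import Data.Unit using (tt)
open import Data.Product using (Σ-syntax; _×_; _,_)
open import Relation.Binary.PropositionalEquality using (_≡_; refl)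

open CTS
open Model
open IsSimulation

module Preservation {Act : Set} {L₁ L₂ : CTS Act} (R : S L₁ → S L₂ → Set)
  (forth : ∀ {x y a x'} → R x y → Tr L₁ x a x' → Σ[ y' ∈ S L₂ ] (Tr L₂ y a y' × R x' y'))
  (shrink : ∀ {x y} → R x y → lab L₂ y ⊆L lab L₁ x) where

  preserves : ∀ (φ : Fm Act) {x y} → R x y → L₁ ⊨[ x ] φ → L₂ ⊨[ y ] φ
  preserves ⊤f        r _          = tt
  preserves (φ ∧f ψ)  r (hφ , hψ)  = preserves φ r hφ , preserves ψ r hψ
  preserves (⟨ a ⟩ φ) r (t , tr , h) with forth r tr
  ... | t' , tr' , r' = t' , tr' , preserves φ r' h
  preserves (! A)     r h b b∈     = h b (shrink r b b∈)

simulation-preserves : {Act : Set} {N M : Model Act} → Simulation N M →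
                       (φ : Fm Act) → N ⊨m φ → M ⊨m φ
simulation-preserves (R , sim) φ =
  Preservation.preserves R (step sim) (label sim) φ (start sim)

prefix-embedding : {Act : Set} (a : Act) (M : Model Act) →
                   Simulation M (cts (prefix a M) ,, just (state M))
prefix-embedding a M = (λ x y → y ≡ just x) , record
  { start = refl
  ; step  = λ { refl tr → _ , Prefix.old tr , refl }
  ; label = λ { refl b b∈ → b∈ } }

simpl-sound : {Act : Set} {φ : Fm Act} {M : Model Act} → Simpl φ (just M) → M ⊨m φ
simpl-sound s-⊤     = tt
simpl-sound (s-! A) = λ b b∈ → b∈
simpl-sound {φ = φ₁ ∧f φ₂} (s-∧ {m₁ = just M₁} {m₂ = just M₂} d₁ d₂ (G⪯M₁ , G⪯M₂ , _)) =
  simulation-preserves G⪯M₁ φ₁ (simpl-sound d₁) , simulation-preserves G⪯M₂ φ₂ (simpl-sound d₂)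
simpl-sound (s-∧ {m₁ = nothing} _ _ (lift () , _))
simpl-sound (s-∧ {m₁ = just _} {m₂ = nothing} _ _ (_ , lift () , _))
simpl-sound {φ = ⟨ a ⟩ φ} (s-⟨⟩ {M = M} d) =
  just (state M) , Prefix.new , simulation-preserves (prefix-embedding a M) φ (simpl-sound d)

-- If M has an a-successor t with (M at t) ⪯ N, then M ⪯ prefix a N: the fresh
-- root of prefix a N is related to the root of M, old states as before.
prefix-below : {Act : Set} {a : Act} (M N : Model Act) {t : S (cts M)} →
               Tr (cts M) (state M) a t → Simulation N (cts M ,, t) →
               Simulation (prefix a N) M
prefix-below {a = a} M N {t} tr (R , sim) =
  R⁺ , record { start = refl ; step = forth ; label = λ {x} → shrink {x} }
  where
  R⁺ : Maybe (S (cts N)) → S (cts M) → Set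
  R⁺ nothing  y = y ≡ state M
  R⁺ (just x) y = R x y

  forth : ∀ {x y b x'} → R⁺ x y → Prefix.PTr a N x b x' →
          Σ[ y' ∈ S (cts M) ] (Tr (cts M) y b y' × R⁺ x' y')
  forth refl Prefix.new     = t , tr , start sim
  forth r    (Prefix.old p) = step sim r p

  shrink : ∀ {x y} → R⁺ x y → lab (cts M) y ⊆L Prefix.plab a N x
  shrink {nothing} _ _ _ = tt
  shrink {just _}  r     = label sim r

single-above : {Act : Set} (M : Model Act) {l : Label Act} →
               lab (cts M) (state M) ⊆L l → Simulation (single l) M
single-above M l⊇ = (λ _ y → y ≡ state M) , record
  { start = refl ; step = λ _ () ; label = λ { refl → l⊇ } }

simpl-characteristic : {Act : Set} {ψ : Fm Act} {n : Maybe (Model Act)} →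
                       Simpl ψ n → (M : Model Act) → M ⊨m ψ → just M ⊑ n
simpl-characteristic s-⊤     M _ = single-above M (λ _ _ → tt)
simpl-characteristic (s-! A) M h = single-above M h
simpl-characteristic (s-∧ d₁ d₂ (_ , _ , greatest)) M (h₁ , h₂) =
  greatest (just M) (simpl-characteristic d₁ M h₁) (simpl-characteristic d₂ M h₂)
simpl-characteristic (s-⟨⟩⊥ d) M (t , _ , h) with simpl-characteristic d (cts M ,, t) h
... | lift ()
simpl-characteristic (s-⟨⟩ {M = N} d) M (t , tr , h) =
  prefix-below M N tr (simpl-characteristic d (cts M ,, t) h)

mainTheorem9 : {Act : Set} → Act → (φ ψ : Fm Act) → φ ⊨ ψ →
               (m n : Maybe (Model Act)) → Simpl φ m → Simpl ψ n → m ⊑ n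
mainTheorem9 _ φ ψ φ⊨ψ nothing  n _  _  = lift tt
mainTheorem9 _ φ ψ φ⊨ψ (just M) n dφ dψ =
  simpl-characteristic dψ M (φ⊨ψ M (simpl-sound dφ))
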